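{- Let $r$ be a positive integer and $p=2r+3$. Let $c=1-\frac{3(p-2)^2}{p}$ and, for $1\le s\le (p-1)/2$, $h_{1,s}=\frac{(p-2s)^2-(p-2)^2}{8p}$. Let $n_p$ be the smallest positive integer $n$ such that $n\,(h_{1,s}-c/24)\in\mathbb{Z}$ for all $1\le s\le(p-1)/2$. Then $n_p=\dfrac{12(2r+3)}{\gcd(4,r)\gcd(3,r)}$.
   Context: $c$ is the central charge of the Virasoro minimal model $L_{2,p}$ of type $(2,p)$ and the $h_{1,s}$, $1\le s\le (p-1)/2$, are the conformal weights of its simple modules; $n_p$ is the level $n$ such that all characters of $L_{2,p}$-modules are modular functions on the principal congruence subgroup $\Gamma(n)$. -}

module Defs where

open import Data.Nat as ℕ using (ℕ; suc; NonZero; ≢-nonZero)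
open import Data.Nat.GCD using (gcd; gcd[m,n]≢0)
open import Data.Nat.Properties using (m*n≢0)
open import Data.Sum using (inj₁)
open import Data.Integer as ℤ using (ℤ; +_)
open import Data.Rational as ℚ using (ℚ; 1ℚ; _/_)

-- p = 2r + 3 (written 3 + 2r so that NonZero instances reduce)
pOf : ℕ → ℕ
pOf r = 3 ℕ.+ 2 ℕ.* r

cc : ℕ → ℚ
cc r = 1ℚ ℚ.- ((+ 3) ℤ.* ((+ pOf r ℤ.- + 2) ℤ.* (+ pOf r ℤ.- + 2))) / pOf r

h1 : ℕ → ℕ → ℚ
h1 r s = (((+ pOf r ℤ.- + (2 ℕ.* s)) ℤ.* (+ pOf r ℤ.- + (2 ℕ.* s)))
          ℤ.- ((+ pOf r ℤ.- + 2) ℤ.* (+ pOf r ℤ.- + 2))) / (8 ℕ.* pOf r)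

IsInt : ℚ → Set
IsInt q = Data.Product.Σ ℤ (λ z → q Relation.Binary.PropositionalEquality.≡ z / 1)
  where import Data.Product
        import Relation.Binary.PropositionalEquality

Good : ℕ → ℕ → Set
Good r n = ∀ (s : ℕ) → 1 ℕ.≤ s → s ℕ.≤ (pOf r ℕ.∸ 1) ℕ./ 2 →
  IsInt ((+ n / 1) ℚ.* (h1 r s ℚ.- cc r ℚ.* (+ 1 / 24)))

gcdProd≢0 : ∀ r → NonZero (gcd 4 r ℕ.* gcd 3 r)
gcdProd≢0 r = m*n≢0 (gcd 4 r) (gcd 3 r)
  {{≢-nonZero (gcd[m,n]≢0 4 r (inj₁ (λ ())))}}
  {{≢-nonZero (gcd[m,n]≢0 3 r (inj₁ (λ ())))}}

formula : ℕ → ℕ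
formula r = (12 ℕ.* pOf r) ℕ./ (gcd 4 r ℕ.* gcd 3 r)
  where instance _ = gcdProd≢0 r

-- Subtracting c/24 cancels the (p - 2)² terms: 24p (h_{1,s} - c/24) = 3(p - 2s)² - p. Writing
-- p - 2s = 2a + 1 with 0 ≤ a ≤ r, this is 12a(a + 1) - 2r, so the condition on n is that 24p divides
-- n (12a(a + 1) - 2r) for all such a. The cases a = 0 and a = 1 force p ∣ n and 12p ∣ n r, i.e.
-- n = j p with 12 ∣ j r, i.e. 12 / gcd(12, r) divides j. Conversely n = 12p / gcd(12, r) works since
-- a(a + 1) is even. Finally gcd(12, r) = gcd(4, r) gcd(3, r), as one checks on the residues mod 12.
module Submission where

open import Defs
open import Data.Nat using (ℕ; _≤_; _<_)
open import Data.Product using (_×_; _,_)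
open import Data.List using (_∷_; [])
open import Data.Nat as ℕ using (suc; zero; s≤s; z≤n; NonZero; ≢-nonZero)
open import Data.Nat.Properties as ℕ using (*-comm; m∸n+n≡m; ≤-refl; n≤1+n)
open import Data.Nat.Divisibility
  using ( _∣_; divides; divides-refl; ∣m∣n⇒∣m+n; ∣m+n∣m⇒∣n; ∣n⇒∣m*n; n∣m*n; ∣⇒≤
        ; *-monoʳ-∣; *-monoˡ-∣; *-cancelˡ-∣; *-cancelʳ-∣)
open import Data.Nat.DivMod
  using (_/_; _%_; m≡m%n+[m/n]*n; m%n<n; m*n/n≡m; m/n*n≡m; *-/-assoc; m≥n⇒m/n>0; /-congʳ)
open import Data.Nat.GCD
  using ( gcd; gcd-GCD; module GCD; gcd[m,n]∣m; gcd[m,n]∣n; gcd-greatest; gcd[m,n]≢0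
        ; c*gcd[m,n]≡gcd[cm,cn])
import Data.Nat.Tactic.RingSolver as ℕ-Ring
open import Data.Sum using (inj₁)
open import Data.Integer as ℤ using (ℤ; +_)
open import Data.Integer.Properties using (pos-*; pos-+; *-identityʳ)
open import Data.Integer.Divisibility.Signed as ℤ∣ using (∣ᵤ⇒∣; ∣⇒∣ᵤ) renaming (_∣_ to _∣ℤ_)
open import Data.Integer.Tactic.RingSolver using (solve-∀; solve)
open import Data.Rational as ℚ using (1ℚ; toℚᵘ)
open import Data.Rational.Unnormalised as ℚᵘ using (mkℚᵘ; *≡*; _≃_)
open import Data.Rational.Unnormalised.Properties using (≃-trans; +-cong; *-cong; -‿cong)
open import Data.Rational.Properties
  using ( toℚᵘ-fromℚᵘ; toℚᵘ-homo-*; toℚᵘ-homo-+; toℚᵘ-homo‿-; fromℚᵘ-toℚᵘ; fromℚᵘ-cong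
        ; fromℚᵘ-injective)
open import Relation.Binary.PropositionalEquality

gcd[m,n+km]≡gcd[m,n] : ∀ m n k → gcd m (n ℕ.+ k ℕ.* m) ≡ gcd m n
gcd[m,n+km]≡gcd[m,n] m n k = GCD.unique (gcd-GCD m (n ℕ.+ k ℕ.* m)) (GCD.is
  (gcd[m,n]∣m m n , ∣m∣n⇒∣m+n (gcd[m,n]∣n m n) (∣n⇒∣m*n k (gcd[m,n]∣m m n)))
  (λ { {d} (d∣m , d∣n+km) →
    gcd-greatest d∣m (∣m+n∣m⇒∣n (subst (d ∣_) (ℕ.+-comm n (k ℕ.* m)) d∣n+km) (∣n⇒∣m*n k d∣m)) }))

gcd[4,t]*gcd[3,t]≡gcd[12,t] : ∀ t → t < 12 → gcd 4 t ℕ.* gcd 3 t ≡ gcd 12 t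
gcd[4,t]*gcd[3,t]≡gcd[12,t] 0  _ = refl
gcd[4,t]*gcd[3,t]≡gcd[12,t] 1  _ = refl
gcd[4,t]*gcd[3,t]≡gcd[12,t] 2  _ = refl
gcd[4,t]*gcd[3,t]≡gcd[12,t] 3  _ = refl
gcd[4,t]*gcd[3,t]≡gcd[12,t] 4  _ = refl
gcd[4,t]*gcd[3,t]≡gcd[12,t] 5  _ = refl
gcd[4,t]*gcd[3,t]≡gcd[12,t] 6  _ = refl
gcd[4,t]*gcd[3,t]≡gcd[12,t] 7  _ = refl
gcd[4,t]*gcd[3,t]≡gcd[12,t] 8  _ = refl
gcd[4,t]*gcd[3,t]≡gcd[12,t] 9  _ = refl
gcd[4,t]*gcd[3,t]≡gcd[12,t] 10 _ = refl
gcd[4,t]*gcd[3,t]≡gcd[12,t] 11 _ = refl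
gcd[4,t]*gcd[3,t]≡gcd[12,t] (suc (suc (suc (suc (suc (suc (suc (suc (suc (suc (suc (suc _))))))))))))
  (s≤s (s≤s (s≤s (s≤s (s≤s (s≤s (s≤s (s≤s (s≤s (s≤s (s≤s (s≤s ()))))))))))))

gcd[4,r]*gcd[3,r]≡gcd[12,r] : ∀ r → gcd 4 r ℕ.* gcd 3 r ≡ gcd 12 r
gcd[4,r]*gcd[3,r]≡gcd[12,r] r = begin
    gcd 4 r ℕ.* gcd 3 r
  ≡⟨ cong (λ x → gcd 4 x ℕ.* gcd 3 x) r≡t+q*12 ⟩
    gcd 4 (t ℕ.+ q ℕ.* 12) ℕ.* gcd 3 (t ℕ.+ q ℕ.* 12)
  ≡⟨ cong₂ ℕ._*_ (residue 4 3) (residue 3 4) ⟩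
    gcd 4 t ℕ.* gcd 3 t
  ≡⟨ gcd[4,t]*gcd[3,t]≡gcd[12,t] t (m%n<n r 12) ⟩
    gcd 12 t
  ≡⟨ residue 12 1 ⟨
    gcd 12 (t ℕ.+ q ℕ.* 12)
  ≡⟨ cong (gcd 12) r≡t+q*12 ⟨
    gcd 12 r ∎
  where
  open ≡-Reasoning
  t = r % 12
  q = r / 12
  r≡t+q*12 : r ≡ t ℕ.+ q ℕ.* 12
  r≡t+q*12 = m≡m%n+[m/n]*n r 12
  residue : ∀ d e → gcd d (t ℕ.+ q ℕ.* (e ℕ.* d)) ≡ gcd d t
  residue d e = trans (cong (λ k → gcd d (t ℕ.+ k)) (sym (ℕ.*-assoc q e d)))
                      (gcd[m,n+km]≡gcd[m,n] d t (q ℕ.* e))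

2∣n*[1+n] : ∀ n → 2 ∣ n ℕ.* suc n
2∣n*[1+n] zero    = divides 0 refl
2∣n*[1+n] (suc n) = subst (2 ∣_) (expand n) (∣m∣n⇒∣m+n (2∣n*[1+n] n) (n∣m*n (suc n)))
  where
  expand : ∀ n → n ℕ.* suc n ℕ.+ suc n ℕ.* 2 ≡ suc n ℕ.* suc (suc n)
  expand = ℕ-Ring.solve-∀

pos-*-* : ∀ a b c → + (a ℕ.* (b ℕ.* c)) ≡ + a ℤ.* (+ b ℤ.* + c)
pos-*-* a b c = trans (pos-* a (b ℕ.* c)) (cong (ℤ._*_ (+ a)) (pos-* b c))

IsInt⇒∣ : ∀ z d → IsInt (z ℚ./ suc d) → + suc d ∣ℤ z
IsInt⇒∣ z d (q , z/d≡q) with fromℚᵘ-injective {mkℚᵘ z d} {mkℚᵘ q 0} z/d≡q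
... | *≡* eq = ℤ∣.divides q (trans (sym (*-identityʳ z)) eq)

∣⇒IsInt : ∀ z d → + suc d ∣ℤ z → IsInt (z ℚ./ suc d)
∣⇒IsInt z d (ℤ∣.divides q eq) =
  q , fromℚᵘ-cong {mkℚᵘ z d} {mkℚᵘ q 0} (*≡* (trans (*-identityʳ z) eq))

toℚᵘ-/ : ∀ z d → toℚᵘ (z ℚ./ suc d) ≃ mkℚᵘ z d
toℚᵘ-/ z d = toℚᵘ-fromℚᵘ (mkℚᵘ z d)

numerator : ℕ → ℕ → ℤ
numerator r s = + 3 ℤ.* ((P ℤ.- T) ℤ.* (P ℤ.- T)) ℤ.- P
  where
  P = + pOf r
  T = + (2 ℕ.* s)

-- The cross-multiplied form of n (h_{1,s} - c/24) = n numerator / 24p in ℚᵘ, with P = p, T = 2s and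
-- the denominators that toℚᵘ produces abstracted as a, b, c, d.
cross-multiplied : ∀ (N P T a b c d : ℤ) →
  a ≡ + 24 ℤ.* P → b ≡ + 8 ℤ.* P → c ≡ + 24 ℤ.* P → d ≡ + 192 ℤ.* P ℤ.* P →
  (N ℤ.* (((P ℤ.- T) ℤ.* (P ℤ.- T) ℤ.- (P ℤ.- + 2) ℤ.* (P ℤ.- + 2)) ℤ.* a
     ℤ.+ ℤ.- ((+ 1 ℤ.* P ℤ.+ ℤ.- (+ 3 ℤ.* ((P ℤ.- + 2) ℤ.* (P ℤ.- + 2))) ℤ.* + 1) ℤ.* + 1) ℤ.* b))
     ℤ.* c
  ≡ (N ℤ.* (+ 3 ℤ.* ((P ℤ.- T) ℤ.* (P ℤ.- T)) ℤ.- P)) ℤ.* d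
cross-multiplied N P T _ _ _ _ refl refl refl refl = solve (N ∷ P ∷ T ∷ [])

module _ (r n s : ℕ) where
  private
    P = + pOf r
    T = + (2 ℕ.* s)
    weight = (+ n ℚ./ 1) ℚ.* (h1 r s ℚ.- cc r ℚ.* (+ 1 ℚ./ 24))
    hNum = (P ℤ.- T) ℤ.* (P ℤ.- T) ℤ.- (P ℤ.- + 2) ℤ.* (P ℤ.- + 2)
    cNum = + 3 ℤ.* ((P ℤ.- + 2) ℤ.* (P ℤ.- + 2))
    weightᵘ = mkℚᵘ (+ n) 0 ℚᵘ.* (mkℚᵘ hNum (ℕ.pred (8 ℕ.* pOf r))
               ℚᵘ.- (mkℚᵘ (+ 1) 0 ℚᵘ.- mkℚᵘ cNum (ℕ.pred (pOf r))) ℚᵘ.* mkℚᵘ (+ 1) 23)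

    toℚᵘ-weight : toℚᵘ weight ≃ weightᵘ
    toℚᵘ-weight =
      ≃-trans (toℚᵘ-homo-* (+ n ℚ./ 1) (h1 r s ℚ.- cc r ℚ.* (+ 1 ℚ./ 24))) (*-cong (toℚᵘ-/ (+ n) 0)
      (≃-trans (toℚᵘ-homo-+ (h1 r s) (ℚ.- (cc r ℚ.* (+ 1 ℚ./ 24))))
        (+-cong (toℚᵘ-/ hNum (ℕ.pred (8 ℕ.* pOf r)))
      (≃-trans (toℚᵘ-homo‿- (cc r ℚ.* (+ 1 ℚ./ 24))) (-‿cong
      (≃-trans (toℚᵘ-homo-* (cc r) (+ 1 ℚ./ 24)) (*-cong
        (≃-trans (toℚᵘ-homo-+ 1ℚ (ℚ.- (cNum ℚ./ pOf r))) (+-cong (toℚᵘ-/ (+ 1) 0)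
          (≃-trans (toℚᵘ-homo‿- (cNum ℚ./ pOf r)) (-‿cong (toℚᵘ-/ cNum (ℕ.pred (pOf r)))))))
        (toℚᵘ-/ (+ 1) 23))))))))

    weightᵘ≃ : weightᵘ ≃ mkℚᵘ (+ n ℤ.* numerator r s) (ℕ.pred (24 ℕ.* pOf r))
    weightᵘ≃ = *≡* (cross-multiplied (+ n) P T _ _ _ _
      (trans (cong +_ (denominator₁ (pOf r))) (pos-* 24 (pOf r)))
      (pos-* 8 (pOf r))
      (pos-* 24 (pOf r))
      (trans (cong +_ (denominator₂ (pOf r)))
             (trans (pos-* (192 ℕ.* pOf r) (pOf r)) (cong (ℤ._* P) (pos-* 192 (pOf r))))))
      where
      denominator₁ : ∀ p → (1 ℕ.* p) ℕ.* 24 ≡ 24 ℕ.* p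
      denominator₁ = ℕ-Ring.solve-∀
      denominator₂ : ∀ p → 1 ℕ.* (8 ℕ.* p ℕ.* ((1 ℕ.* p) ℕ.* 24)) ≡ 192 ℕ.* p ℕ.* p
      denominator₂ = ℕ-Ring.solve-∀

  scaled-weight≡numerator/24p :
    (+ n ℚ./ 1) ℚ.* (h1 r s ℚ.- cc r ℚ.* (+ 1 ℚ./ 24)) ≡ (+ n ℤ.* numerator r s) ℚ./ (24 ℕ.* pOf r)
  scaled-weight≡numerator/24p =
    trans (sym (fromℚᵘ-toℚᵘ weight)) (fromℚᵘ-cong (≃-trans toℚᵘ-weight weightᵘ≃))

numerator[a+t,1+t]≡ : ∀ a t →
  numerator (a ℕ.+ t) (suc t) ≡ + 12 ℤ.* + (a ℕ.* suc a) ℤ.- + 2 ℤ.* + (a ℕ.+ t)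
numerator[a+t,1+t]≡ a t = begin
    numerator (a ℕ.+ t) (suc t)
  ≡⟨ cong₂ (λ P T → + 3 ℤ.* ((P ℤ.- T) ℤ.* (P ℤ.- T)) ℤ.- P) p≡3+2[A+T] (pos-* 2 (suc t)) ⟩
    + 3 ℤ.* ((3+2[A+T] ℤ.- + 2 ℤ.* (+ 1 ℤ.+ T)) ℤ.* (3+2[A+T] ℤ.- + 2 ℤ.* (+ 1 ℤ.+ T))) ℤ.- 3+2[A+T]
  ≡⟨ polynomial A T ⟩
    + 12 ℤ.* (A ℤ.* (+ 1 ℤ.+ A)) ℤ.- + 2 ℤ.* (A ℤ.+ T)
  ≡⟨ cong₂ (λ x y → + 12 ℤ.* x ℤ.- + 2 ℤ.* y) (pos-* a (suc a)) (pos-+ a t) ⟨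
    + 12 ℤ.* + (a ℕ.* suc a) ℤ.- + 2 ℤ.* + (a ℕ.+ t) ∎
  where
  open ≡-Reasoning
  A = + a
  T = + t
  3+2[A+T] = + 3 ℤ.+ + 2 ℤ.* (A ℤ.+ T)
  p≡3+2[A+T] : + pOf (a ℕ.+ t) ≡ 3+2[A+T]
  p≡3+2[A+T] = trans (pos-+ 3 (2 ℕ.* (a ℕ.+ t)))
    (cong (ℤ._+_ (+ 3)) (trans (pos-* 2 (a ℕ.+ t)) (cong (ℤ._*_ (+ 2)) (pos-+ a t))))
  polynomial : ∀ x y →
    + 3 ℤ.* (((+ 3 ℤ.+ + 2 ℤ.* (x ℤ.+ y)) ℤ.- + 2 ℤ.* (+ 1 ℤ.+ y))
             ℤ.* ((+ 3 ℤ.+ + 2 ℤ.* (x ℤ.+ y)) ℤ.- + 2 ℤ.* (+ 1 ℤ.+ y)))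
      ℤ.- (+ 3 ℤ.+ + 2 ℤ.* (x ℤ.+ y))
    ≡ + 12 ℤ.* (x ℤ.* (+ 1 ℤ.+ x)) ℤ.- + 2 ℤ.* (x ℤ.+ y)
  polynomial = solve-∀

numerator[r,1+t]≡ : ∀ {r t} → t ≤ r →
  numerator r (suc t) ≡ + 12 ℤ.* + ((r ℕ.∸ t) ℕ.* suc (r ℕ.∸ t)) ℤ.- + 2 ℤ.* + r
numerator[r,1+t]≡ {r} {t} t≤r =
  subst (λ x → numerator x (suc t) ≡ + 12 ℤ.* + (a ℕ.* suc a) ℤ.- + 2 ℤ.* + x)
        (m∸n+n≡m t≤r) (numerator[a+t,1+t]≡ a t)
  where a = r ℕ.∸ t

[p-1]/2≡1+r : ∀ r → (pOf r ℕ.∸ 1) / 2 ≡ suc r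
[p-1]/2≡1+r r = trans (cong (_/ 2) (p-1≡[1+r]*2 r)) (m*n/n≡m (suc r) 2)
  where
  p-1≡[1+r]*2 : ∀ r → 2 ℕ.+ 2 ℕ.* r ≡ suc r ℕ.* 2
  p-1≡[1+r]*2 = ℕ-Ring.solve-∀

-- s = t + 1 runs over 1 ≤ s ≤ (p - 1)/2 = r + 1.
DividesNumerators : ℕ → ℕ → Set
DividesNumerators r n = ∀ t → t ≤ r → + (24 ℕ.* pOf r) ∣ℤ + n ℤ.* numerator r (suc t)

Good⇒DividesNumerators : ∀ r n → Good r n → DividesNumerators r n
Good⇒DividesNumerators r n good t t≤r =
  IsInt⇒∣ _ _ (subst IsInt (scaled-weight≡numerator/24p r n (suc t))
    (good (suc t) (s≤s z≤n) (subst (suc t ≤_) (sym ([p-1]/2≡1+r r)) (s≤s t≤r))))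

DividesNumerators⇒Good : ∀ r n → DividesNumerators r n → Good r n
DividesNumerators⇒Good r n div (suc t) _ s≤[p-1]/2 =
  subst IsInt (sym (scaled-weight≡numerator/24p r n (suc t)))
    (∣⇒IsInt _ _ (div t (ℕ.≤-pred (subst (suc t ≤_) ([p-1]/2≡1+r r) s≤[p-1]/2))))

module _ (r : ℕ) where
  private
    instance
      gcd[12,r]≢0 : NonZero (gcd 12 r)
      gcd[12,r]≢0 = ≢-nonZero (gcd[m,n]≢0 12 r (inj₁ (λ ())))

  cofactor : ℕ
  cofactor = 12 / gcd 12 r

  cofactor*gcd≡12 : cofactor ℕ.* gcd 12 r ≡ 12
  cofactor*gcd≡12 = m/n*n≡m (gcd[m,n]∣m 12 r)

  formula≡cofactor*p : formula r ≡ cofactor ℕ.* pOf r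
  formula≡cofactor*p = begin
      formula r
    ≡⟨ /-congʳ {{gcdProd≢0 r}} (gcd[4,r]*gcd[3,r]≡gcd[12,r] r) ⟩
      (12 ℕ.* pOf r) / gcd 12 r
    ≡⟨ cong (_/ gcd 12 r) (*-comm 12 (pOf r)) ⟩
      (pOf r ℕ.* 12) / gcd 12 r
    ≡⟨ *-/-assoc (pOf r) (gcd[m,n]∣m 12 r) ⟩
      pOf r ℕ.* cofactor
    ≡⟨ *-comm (pOf r) cofactor ⟩
      cofactor ℕ.* pOf r ∎
    where open ≡-Reasoning

  formula>0 : 0 < formula r
  formula>0 = subst (0 <_) (sym formula≡cofactor*p)
    (ℕ.*-mono-≤ (m≥n⇒m/n>0 (∣⇒≤ (gcd[m,n]∣m 12 r))) (s≤s z≤n))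

  12∣cofactor*r : 12 ∣ cofactor ℕ.* r
  12∣cofactor*r = subst (_∣ cofactor ℕ.* r) cofactor*gcd≡12 (*-monoʳ-∣ cofactor (gcd[m,n]∣n 12 r))

  -- 12 divides gcd (12 j, j r) = j gcd (12, r).
  cofactor∣ : ∀ {j} → 12 ∣ j ℕ.* r → cofactor ∣ j
  cofactor∣ {j} 12∣jr = *-cancelʳ-∣ (gcd 12 r)
    (subst₂ _∣_ (sym cofactor*gcd≡12) (sym (c*gcd[m,n]≡gcd[cm,cn] j 12 r)) (gcd-greatest (n∣m*n j) 12∣jr))

cofactor*p∣n : ∀ r p n .{{_ : NonZero p}} → p ∣ n → 12 ℕ.* p ∣ n ℕ.* r → cofactor r ℕ.* p ∣ n
cofactor*p∣n r p .(j ℕ.* p) (divides-refl j) 12p∣jpr =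
  *-monoˡ-∣ p (cofactor∣ r {j} (*-cancelʳ-∣ p (subst (12 ℕ.* p ∣_) (regroup j p r) 12p∣jpr)))
  where
  regroup : ∀ j p r → j ℕ.* p ℕ.* r ≡ j ℕ.* r ℕ.* p
  regroup = ℕ-Ring.solve-∀

formula-sufficient : ∀ r → DividesNumerators r (formula r)
formula-sufficient r t t≤r =
  subst₂ _∣ℤ_ 24p≡ (sym value≡) (ℤ∣.*-monoʳ-∣ (+ p) (ℤ∣.∣m∣n⇒∣m-n 24∣12mq 24∣2mr))
  where
  open ≡-Reasoning
  m = cofactor r
  p = pOf r
  a = r ℕ.∸ t
  q = a ℕ.* suc a
  24∣12mq : + 24 ∣ℤ + (12 ℕ.* (m ℕ.* q))
  24∣12mq = ∣ᵤ⇒∣ (*-monoʳ-∣ 12 (∣n⇒∣m*n m (2∣n*[1+n] a)))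
  24∣2mr : + 24 ∣ℤ + (2 ℕ.* (m ℕ.* r))
  24∣2mr = ∣ᵤ⇒∣ (*-monoʳ-∣ 2 (12∣cofactor*r r))
  24p≡ : + p ℤ.* + 24 ≡ + (24 ℕ.* p)
  24p≡ = trans (sym (pos-* p 24)) (cong +_ (*-comm p 24))
  distribute : ∀ M P Q R →
    (M ℤ.* P) ℤ.* (+ 12 ℤ.* Q ℤ.- + 2 ℤ.* R) ≡ P ℤ.* (+ 12 ℤ.* (M ℤ.* Q) ℤ.- + 2 ℤ.* (M ℤ.* R))
  distribute = solve-∀
  value≡ : + formula r ℤ.* numerator r (suc t) ≡ + p ℤ.* (+ (12 ℕ.* (m ℕ.* q)) ℤ.- + (2 ℕ.* (m ℕ.* r)))
  value≡ = begin
      + formula r ℤ.* numerator r (suc t)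
    ≡⟨ cong₂ ℤ._*_ (trans (cong +_ (formula≡cofactor*p r)) (pos-* m p)) (numerator[r,1+t]≡ t≤r) ⟩
      (+ m ℤ.* + p) ℤ.* (+ 12 ℤ.* + q ℤ.- + 2 ℤ.* + r)
    ≡⟨ distribute (+ m) (+ p) (+ q) (+ r) ⟩
      + p ℤ.* (+ 12 ℤ.* (+ m ℤ.* + q) ℤ.- + 2 ℤ.* (+ m ℤ.* + r))
    ≡⟨ cong₂ (λ x y → + p ℤ.* (x ℤ.- y)) (pos-*-* 12 m q) (pos-*-* 2 m r) ⟨
      + p ℤ.* (+ (12 ℕ.* (m ℕ.* q)) ℤ.- + (2 ℕ.* (m ℕ.* r))) ∎

formula-necessary : ∀ r n → 0 < r → DividesNumerators r n → formula r ∣ n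
formula-necessary r@(suc t) n _ div =
  subst (_∣ n) (sym (formula≡cofactor*p r)) (cofactor*p∣n r p n p∣n 12p∣nr)
  where
  p = pOf r
  N = + n
  R = + r
  at-s=1+r : + (24 ℕ.* p) ∣ℤ N ℤ.* (+ 0 ℤ.- + 2 ℤ.* R)
  at-s=1+r = subst (λ x → + (24 ℕ.* p) ∣ℤ N ℤ.* x) (numerator[a+t,1+t]≡ 0 r) (div r ≤-refl)
  at-s=r : + (24 ℕ.* p) ∣ℤ N ℤ.* (+ 24 ℤ.- + 2 ℤ.* R)
  at-s=r = subst (λ x → + (24 ℕ.* p) ∣ℤ N ℤ.* x) (numerator[a+t,1+t]≡ 1 t) (div t (n≤1+n t))
  difference : ∀ N R → N ℤ.* (+ 24 ℤ.- + 2 ℤ.* R) ℤ.- N ℤ.* (+ 0 ℤ.- + 2 ℤ.* R) ≡ + 24 ℤ.* N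
  difference = solve-∀
  negation : ∀ N R → ℤ.- (N ℤ.* (+ 0 ℤ.- + 2 ℤ.* R)) ≡ + 2 ℤ.* (N ℤ.* R)
  negation = solve-∀
  p∣n : p ∣ n
  p∣n = *-cancelˡ-∣ 24 (∣⇒∣ᵤ (subst (+ (24 ℕ.* p) ∣ℤ_) (trans (difference N R) (sym (pos-* 24 n)))
    (ℤ∣.∣m∣n⇒∣m-n at-s=r at-s=1+r)))
  12p∣nr : 12 ℕ.* p ∣ n ℕ.* r
  12p∣nr = *-cancelˡ-∣ 2 (subst (_∣ 2 ℕ.* (n ℕ.* r)) (ℕ.*-assoc 2 12 p)
    (∣⇒∣ᵤ (subst (+ (24 ℕ.* p) ∣ℤ_) (trans (negation N R) (sym (pos-*-* 2 n r))) (ℤ∣.∣m⇒∣-m at-s=1+r))))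

mainTheorem5 : ∀ (r : ℕ) → 0 < r →
    (0 < formula r × Good r (formula r) × (∀ (n : ℕ) → 0 < n → Good r n → formula r ≤ n))
mainTheorem5 r 0<r =
  formula>0 r ,
  DividesNumerators⇒Good r (formula r) (formula-sufficient r) ,
  λ n 0<n good → ∣⇒≤ {{ℕ.>-nonZero 0<n}} (formula-necessary r n 0<r (Good⇒DividesNumerators r n good))
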